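{- Let $X$ be a finite set, $\mathcal{C}$ a set of partial characters on $X$, $H$ a minimal triangulation of $\operatorname{int}(\mathcal{C})$, $(T,\mathcal{K})$ a clique tree of $H$, and suppose $(T,\mathcal{K})$ induces the $X$-tree $\mathcal{T}$. Then the underlying tree of $\mathcal{T}$ is $T$, and for each vertex $(A,\chi)$ of $\operatorname{int}(\mathcal{C})$, $\mathcal{T}(A) = T_{\mathcal{K}}(A,\chi)$. Further, $H = \operatorname{int}(\mathcal{C},\mathcal{T})$.
   Context: A partial character on $X$ is a partition $\chi$ of a subset of $X$ into nonempty cells. The partition intersection graph $\operatorname{int}(\mathcal{C})$ has vertex set $\{(A,\chi):\chi\in\mathcal{C}, A\text{ a cell of }\chi\}$, distinct vertices $(A,\chi),(A',\chi')$ adjacent iff $A\cap A'\ne\emptyset$. A triangulation of a graph $G$ is a chordal graph obtained from $G$ by adding edges; it is minimal if no proper subset of the added edges yields a triangulation. A clique tree of a chordal graph $G$ is a pair $(T,\mathcal{K})$ with $T$ a tree and $\mathcal{K}$ a bijection from $V(T)$ onto the maximal cliques of $G$ such that vertices $x,y$ are adjacent iff both lie in some $\mathcal{K}(v)$, and for each vertex $x$ the nodes $v$ with $x\in\mathcal{K}(v)$ induce a connected subtree. For a vertex $(A,\chi)$, $T_{\mathcal{K}}(A,\chi)$ denotes the subtree of $T$ consisting of the nodes $v$ with $(A,\chi)\in\mathcal{K}(v)$. An $X$-tree is a pair $\mathcal{T}=(T',\phi)$ where $T'$ (its underlying tree) is a tree and $\phi:X\to V(T')$ is a map such that every node of degree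 one or two lies in the image of $\phi$; for $A\subseteq X$, $\mathcal{T}(A)$ is the minimal subtree of $T'$ containing $\phi(A)$. The graph $\operatorname{int}(\mathcal{C},\mathcal{T})$ has the vertex set of $\operatorname{int}(\mathcal{C})$, distinct vertices $(A,\chi),(A',\chi')$ being adjacent iff $\mathcal{T}(A)$ and $\mathcal{T}(A')$ share a node. Given a clique tree $(T,\mathcal{K})$ of a triangulation of $\operatorname{int}(\mathcal{C})$, a node $v$ is a candidate node for $a\in X$ if $\mathcal{K}(v)$ contains every vertex $(A,\chi)$ of $\operatorname{int}(\mathcal{C})$ with $a\in A$. An $X$-tree induced by $(T,\mathcal{K})$ is obtained by choosing for each $a\in X$ a candidate node $\phi(a)$, and then suppressing every node of $T$ not in the image of $\phi$ that has degree two. -}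

module Defs where

open import Data.Nat using (ℕ; zero; suc; _%_)
open import Data.Fin using (Fin; toℕ)
open import Data.Fin.Subset using (Subset; _∈_; _∩_; Nonempty; Empty; ∣_∣)
open import Data.Vec using (tabulate)
open import Data.Bool using (Bool; true; false)
open import Data.Product using (Σ; ∃; ∃₂; _×_; _,_; proj₁; proj₂)
open import Relation.Nullary using (¬_)
open import Relation.Binary.PropositionalEquality using (_≡_; _≢_)
open import Function.Bundles using (_⇔_)

Rel₂ : Set → Set
Rel₂ V = V → V → Bool

IsGraph : {V : Set} → Rel₂ V → Set
IsGraph {V} E = (∀ (x y : V) → E x y ≡ E y x) × (∀ (x : V) → E x x ≡ false)

Next : ∀ {m} → Fin (suc m) → Fin (suc m) → Set
Next {m} i j = toℕ j ≡ suc (toℕ i) % suc m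

IsCycle : {V : Set} → Rel₂ V → ∀ {m} → (Fin (suc m) → V) → Set
IsCycle E {m} f =
  (∀ i j → f i ≡ f j → i ≡ j) × (∀ i j → Next {m} i j → E (f i) (f j) ≡ true)

Chordal : {V : Set} → Rel₂ V → Set
Chordal E = ∀ (r : ℕ) (f : Fin (suc (suc (suc (suc r)))) → _) → IsCycle E f →
  ∃₂ λ i j → (E (f i) (f j) ≡ true) × ¬ Next i j × ¬ Next j i

data PathIn {V : Set} (E : Rel₂ V) (S : V → Bool) : V → V → Set where
  here : ∀ {u} → S u ≡ true → PathIn E S u u
  step : ∀ {u w v} → S u ≡ true → E u w ≡ true → PathIn E S w v → PathIn E S u v

ConnectedSet : {V : Set} → Rel₂ V → (V → Bool) → Set
ConnectedSet E S = ∀ u v → S u ≡ true → S v ≡ true → PathIn E S u v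

IsTree : ∀ {t} → Rel₂ (Fin t) → Set
IsTree E = IsGraph E × ConnectedSet E (λ _ → true) ×
  (∀ (r : ℕ) (f : Fin (suc (suc (suc r))) → _) → ¬ IsCycle E f)

degree : ∀ {t} → Rel₂ (Fin t) → Fin t → ℕ
degree E v = ∣ tabulate (E v) ∣

IsClique : {V : Set} → Rel₂ V → (V → Bool) → Set
IsClique H Q = ∀ x y → Q x ≡ true → Q y ≡ true → x ≢ y → H x y ≡ true

IsMaximalClique : {V : Set} → Rel₂ V → (V → Bool) → Set
IsMaximalClique H Q = IsClique H Q ×
  (∀ Q' → IsClique H Q' → (∀ x → Q x ≡ true → Q' x ≡ true) →
     ∀ x → Q' x ≡ true → Q x ≡ true)

-- (T , K) is a clique tree of the chordal graph H; T is the tree on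
-- Fin t with adjacency ET, and K v is the clique (as a predicate) at v.
IsCliqueTree : {V : Set} → Rel₂ V → ∀ {t} → Rel₂ (Fin t) → (Fin t → V → Bool) → Set
IsCliqueTree H ET K =
  IsTree ET ×
  (∀ v → IsMaximalClique H (K v)) ×
  (∀ v w → (∀ x → K v x ≡ K w x) → v ≡ w) ×
  (∀ Q → IsMaximalClique H Q → ∃ λ v → ∀ x → K v x ≡ Q x) ×
  (∀ x y → x ≢ y → (H x y ≡ true ⇔ ∃ λ v → K v x ≡ true × K v y ≡ true)) ×
  (∀ x → ConnectedSet ET (λ v → K v x))

-- Partial characters on X = Fin n.  A set C of partial characters is
-- given as a family indexed by Fin m; character i has cells
-- cell i j (j : Fin (k i)).  Vertices of int(C) are pairs (i , j),
-- standing for (cell i j , χ_i).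

Vtx : ∀ {m} → (Fin m → ℕ) → Set
Vtx {m} k = Σ (Fin m) (λ i → Fin (k i))

Cells : ℕ → ∀ {m} → (Fin m → ℕ) → Set
Cells n {m} k = (i : Fin m) → Fin (k i) → Subset n

cellOf : ∀ {n m} {k : Fin m → ℕ} → Cells n k → Vtx k → Subset n
cellOf cell (i , j) = cell i j

SameCells : ∀ {n m} {k : Fin m → ℕ} → Cells n k → Fin m → Fin m → Set
SameCells cell i i' =
  (∀ j → ∃ λ j' → cell i j ≡ cell i' j') × (∀ j' → ∃ λ j → cell i' j' ≡ cell i j)

IsCharacterSet : ∀ {n m} {k : Fin m → ℕ} → Cells n k → Set
IsCharacterSet cell =
  (∀ i j → Nonempty (cell i j)) ×
  (∀ i j j' → j ≢ j' → Empty (cell i j ∩ cell i j')) ×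
  -- C is a set: distinct indices give distinct partial characters
  (∀ i i' → i ≢ i' → ¬ SameCells cell i i')

IntC : ∀ {n m} {k : Fin m → ℕ} → Cells n k → Vtx k → Vtx k → Set
IntC cell x y = x ≢ y × Nonempty (cellOf cell x ∩ cellOf cell y)

IsTriangulation : {V : Set} → (V → V → Set) → Rel₂ V → Set
IsTriangulation G H = IsGraph H × (∀ x y → G x y → H x y ≡ true) × Chordal H

IsMinimalTriangulation : {V : Set} → (V → V → Set) → Rel₂ V → Set
IsMinimalTriangulation G H = IsTriangulation G H ×
  (∀ H' → IsTriangulation G H' → (∀ x y → H' x y ≡ true → H x y ≡ true) →
     ∀ x y → H x y ≡ true → H' x y ≡ true)

IsCandidate : ∀ {n m} {k : Fin m → ℕ} → Cells n k → ∀ {t} →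
  (Fin t → Vtx k → Bool) → Fin n → Fin t → Set
IsCandidate cell K a v = ∀ x → a ∈ cellOf cell x → K v x ≡ true

-- X-trees (T , φ) with T a tree on Fin t.

-- v lies in the minimal subtree 𝒯(A) of T containing φ(A), i.e. in every
-- connected node set containing φ(A).
InSpan : ∀ {n t} → Rel₂ (Fin t) → (Fin n → Fin t) → Subset n → Fin t → Set
InSpan ET φ A v = ∀ (S : Fin _ → Bool) → ConnectedSet ET S →
  (∀ a → a ∈ A → S (φ a) ≡ true) → S v ≡ true

-- Suppressing the degree-2 nodes of T outside the image of φ removes
-- nothing, i.e. the underlying tree of the induced X-tree is T itself.
NoSuppression : ∀ {n t} → Rel₂ (Fin t) → (Fin n → Fin t) → Set
NoSuppression ET φ = ∀ v → degree ET v ≡ 2 → ∃ λ a → φ a ≡ v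

IntCT : ∀ {n m} {k : Fin m → ℕ} → Cells n k → ∀ {t} → Rel₂ (Fin t) →
  (Fin n → Fin t) → Vtx k → Vtx k → Set
IntCT cell ET φ x y =
  x ≢ y × ∃ λ v → InSpan ET φ (cellOf cell x) v × InSpan ET φ (cellOf cell y) v

-- The subtrees T_K(A, χ) represent H as the intersection graph of a family of subtrees of T,
-- and each contains φ(A), hence 𝒯(A). If some T_K(A, χ) contained a node v outside a subtree
-- S ⊇ φ(A), shrink it to its part inside S: the intersection graph of the new family is still
-- chordal (intersection graphs of subtrees of a tree are), contains int(C) and is contained in H,
-- so by minimality it is H. But then the clique at v is contained in the clique at the node where
-- the path from v enters the shrunk subtree, contradicting that distinct nodes carry distinct
-- maximal cliques. So T_K(A, χ) = 𝒯(A), which gives H = int(C, 𝒯); a degree-two node outside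
-- φ(X) is excluded by the same argument, deleting it from a subtree through it.

module Submission where

open import Defs
open import Data.Nat using (ℕ; zero; suc; _+_; _<_; _≤_; _≤?_; _%_; z≤n; s≤s; s≤s⁻¹)
open import Data.Nat.Properties
  using ( suc-injective; ≤-refl; ≤-trans; <⇒≤; n≤1+n; n<1+n; 1+n≰n; n≮0
        ; m≤n⇒m≤1+n; m<n⇒m<1+n; m≤n⇒m<n∨m≡n)
open import Data.Nat.DivMod using (m<n⇒m%n≡m; n%n≡0; m%n<n; m%n%n≡m%n; %-distribˡ-+)
open import Data.Fin using (Fin; zero; suc; toℕ; fromℕ<; _≟_)
open import Data.Fin.Properties using (toℕ-injective; toℕ<n; toℕ-fromℕ<; any?)
open import Data.Fin.Subset using (Subset; Nonempty; ∣_∣) renaming (_∈_ to _∈ₛ_; _∉_ to _∉ₛ_)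
open import Data.Fin.Subset.Properties using (x∈p∩q⁻)
open import Data.Vec using (_∷_; tabulate)
open import Data.Vec.Properties using (lookup∘tabulate; []=⇒lookup; lookup⇒[]=)
open import Data.Vec.Base using (module _[_]=_)
open _[_]=_ using (here; there)
open import Data.Bool using (Bool; true; false; _∧_; not; if_then_else_)
open import Data.Bool.Properties using (not-¬; ¬-not; ∧-conicalˡ; ∧-conicalʳ) renaming (_≟_ to _≟B_)
open import Data.Product using (Σ; ∃; ∃₂; _×_; _,_; proj₁; proj₂)
open import Data.Product.Properties using (≡-dec)
open import Data.Sum using (_⊎_; inj₁; inj₂)
import Data.Sum as Sum
open import Data.Unit using (⊤; tt)
open import Data.Empty using (⊥; ⊥-elim)
open import Data.List using (List; []; _∷_)
open import Data.List.Relation.Unary.Any using (here; there)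
open import Data.List.Membership.Propositional using (_∈_; _∉_)
open import Level using (0ℓ)
open import Relation.Binary using (Rel; Symmetric; _⇒_; DecidableEquality)
open import Relation.Binary.Construct.Closure.ReflexiveTransitive
  using (Star; ε; _◅_; _◅◅_; map; reverse)
open import Relation.Binary.PropositionalEquality
open import Relation.Nullary using (¬_; Dec; yes; no)
open import Relation.Nullary.Decidable using (isYes; ¬?; _×-dec_)
open import Function using (_∘_)
open import Function.Bundles using (_⇔_; mk⇔; Equivalence)

bool-ext : ∀ {b b′ : Bool} → (b ≡ true → b′ ≡ true) → (b′ ≡ true → b ≡ true) → b ≡ b′
bool-ext {true} to _ = sym (to refl)
bool-ext {false} {true} _ from = from refl
bool-ext {false} {false} _ _ = refl

∧≡true⇒ : ∀ {x y} → x ∧ y ≡ true → x ≡ true × y ≡ true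
∧≡true⇒ {true} y≡true = refl , y≡true

-- The second hypothesis excludes the wrap-around pair (i, j) = (0, m).
non-consecutive : ∀ {m} {i j : Fin (suc m)} → 2 + toℕ i ≤ toℕ j → 0 < toℕ i ⊎ 2 + toℕ j ≤ suc m →
  ¬ Next i j × ¬ Next j i
non-consecutive {m} {i} {j} i+2≤j wrap = not-i→j , not-j→i
  where
  not-i→j : ¬ Next i j
  not-i→j next = 1+n≰n (subst (2 + toℕ i ≤_)
    (trans next (m<n⇒m%n≡m (≤-trans i+2≤j (<⇒≤ (toℕ<n j))))) i+2≤j)
  not-j→i : ¬ Next j i
  not-j→i next with m≤n⇒m<n∨m≡n (toℕ<n j)
  ... | inj₁ j+1<1+m = 1+n≰n (≤-trans (≤-trans (n≤1+n _) (n≤1+n _))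
                          (subst (λ k → 2 + k ≤ toℕ j) (trans next (m<n⇒m%n≡m j+1<1+m)) i+2≤j))
  ... | inj₂ j+1≡1+m = wraps-to-0 wrap (trans next (trans (cong (_% suc m) j+1≡1+m) (n%n≡0 (suc m))))
    where
    wraps-to-0 : 0 < toℕ i ⊎ 2 + toℕ j ≤ suc m → toℕ i ≢ 0
    wraps-to-0 (inj₁ 0<i) i≡0 = n≮0 (subst (0 <_) i≡0 0<i)
    wraps-to-0 (inj₂ j+2≤1+m) _ = 1+n≰n (subst (2 + toℕ j ≤_) (sym j+1≡1+m) j+2≤1+m)

module Tree {t : ℕ} (E : Rel₂ (Fin t)) (tree : IsTree E) where
  open import Data.List.Membership.DecPropositional (_≟_ {t}) using (_∈?_)

  Edge : Rel (Fin t) 0ℓ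
  Edge x y = E x y ≡ true

  Edge-sym : Symmetric Edge
  Edge-sym {x} {y} e = trans (proj₁ (proj₁ tree) y x) e

  Edge-irrefl : ∀ {x} → ¬ Edge x x
  Edge-irrefl {x} e = not-¬ e (proj₂ (proj₁ tree) x)

  EdgeWithin : (Fin t → Bool) → Rel (Fin t) 0ℓ
  EdgeWithin S x y = Edge x y × S x ≡ true × S y ≡ true

  EdgeAvoiding : Fin t → Rel (Fin t) 0ℓ
  EdgeAvoiding c x y = Edge x y × x ≢ c × y ≢ c

  EdgeOtherThan : Fin t → Fin t → Rel (Fin t) 0ℓ
  EdgeOtherThan p u x y = Edge x y × ¬ (x ≡ p × y ≡ u) × ¬ (x ≡ u × y ≡ p)

  module _ {R : Rel (Fin t) 0ℓ} where

    vertices : ∀ {a b} → Star R a b → List (Fin t)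
    vertices {a} ε = a ∷ []
    vertices {a} (_ ◅ w) = a ∷ vertices w

    start∈vertices : ∀ {a b} (w : Star R a b) → a ∈ vertices w
    start∈vertices ε = here refl
    start∈vertices (_ ◅ w) = here refl

    Simple : ∀ {a b} → Star R a b → Set
    Simple ε = ⊤
    Simple {a} (_ ◅ w) = a ∉ vertices w × Simple w

    suffixFrom : ∀ {a b c} (w : Star R a b) → Simple w → c ∈ vertices w → Σ (Star R c b) Simple
    suffixFrom ε s (here refl) = ε , tt
    suffixFrom (x ◅ w) s (here refl) = x ◅ w , s
    suffixFrom (x ◅ w) (_ , s) (there c∈w) = suffixFrom w s c∈w

    loopErase : ∀ {a b} → Star R a b → Σ (Star R a b) Simple
    loopErase ε = ε , tt
    loopErase {a} (x ◅ w) with loopErase w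
    ... | w' , s with a ∈? vertices w'
    ...   | yes a∈w' = suffixFrom w' s a∈w'
    ...   | no a∉w' = x ◅ w' , a∉w' , s

    length : ∀ {a b} → Star R a b → ℕ
    length ε = 0
    length (_ ◅ w) = suc (length w)

    vertexAt : ∀ {a b} → Star R a b → ℕ → Fin t
    vertexAt {a} ε _ = a
    vertexAt {a} (_ ◅ w) zero = a
    vertexAt (_ ◅ w) (suc i) = vertexAt w i

    vertexAt-end : ∀ {a b} (w : Star R a b) → vertexAt w (length w) ≡ b
    vertexAt-end ε = refl
    vertexAt-end (_ ◅ w) = vertexAt-end w

    vertexAt-∈ : ∀ {a b} (w : Star R a b) i → i ≤ length w → vertexAt w i ∈ vertices w
    vertexAt-∈ ε zero _ = here refl
    vertexAt-∈ (_ ◅ w) zero _ = here refl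
    vertexAt-∈ (_ ◅ w) (suc i) (s≤s i≤) = there (vertexAt-∈ w i i≤)

    vertexAt-injective : ∀ {a b} (w : Star R a b) → Simple w → ∀ i j →
      i ≤ length w → j ≤ length w → vertexAt w i ≡ vertexAt w j → i ≡ j
    vertexAt-injective ε _ zero zero _ _ _ = refl
    vertexAt-injective (_ ◅ w) _ zero zero _ _ _ = refl
    vertexAt-injective (_ ◅ w) (a∉w , _) zero (suc j) _ (s≤s j≤) eq =
      ⊥-elim (a∉w (subst (_∈ vertices w) (sym eq) (vertexAt-∈ w j j≤)))
    vertexAt-injective (_ ◅ w) (a∉w , _) (suc i) zero (s≤s i≤) _ eq =
      ⊥-elim (a∉w (subst (_∈ vertices w) eq (vertexAt-∈ w i i≤)))
    vertexAt-injective (_ ◅ w) (_ , s) (suc i) (suc j) (s≤s i≤) (s≤s j≤) eq =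
      cong suc (vertexAt-injective w s i j i≤ j≤ eq)

    vertexAt-edge : R ⇒ Edge → ∀ {a b} (w : Star R a b) i → i < length w →
      Edge (vertexAt w i) (vertexAt w (suc i))
    vertexAt-edge R⊆E (x ◅ ε) zero _ = R⊆E x
    vertexAt-edge R⊆E (x ◅ _ ◅ _) zero _ = R⊆E x
    vertexAt-edge R⊆E (_ ◅ w) (suc i) (s≤s i<) = vertexAt-edge R⊆E w i i<

    no-simple-cycle : R ⇒ Edge → ∀ {a a′ a″ b} (x : R a a′) (y : R a′ a″) (w : Star R a″ b) →
      Simple (x ◅ y ◅ w) → ¬ Edge b a
    no-simple-cycle R⊆E {a} {b = b} x y w simple b-a =
      proj₂ (proj₂ tree) (length w) cycle (injective , consecutive)
      where
      W : Star R a b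
      W = x ◅ y ◅ w
      cycle : Fin (suc (length W)) → Fin t
      cycle i = vertexAt W (toℕ i)
      bounded : ∀ i → toℕ i ≤ length W
      bounded i = s≤s⁻¹ (toℕ<n i)
      injective : ∀ i j → cycle i ≡ cycle j → i ≡ j
      injective i j eq =
        toℕ-injective (vertexAt-injective W simple (toℕ i) (toℕ j) (bounded i) (bounded j) eq)
      consecutive : ∀ i j → Next i j → E (cycle i) (cycle j) ≡ true
      consecutive i j next with m≤n⇒m<n∨m≡n (bounded i)
      ... | inj₁ i<ℓ = subst (Edge (cycle i) ∘ vertexAt W) j≡i+1 (vertexAt-edge R⊆E W (toℕ i) i<ℓ)
        where
        j≡i+1 : suc (toℕ i) ≡ toℕ j
        j≡i+1 = sym (trans next (m<n⇒m%n≡m (s≤s i<ℓ)))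
      ... | inj₂ i≡ℓ = subst₂ Edge (sym i-is-b) (sym j-is-a) b-a
        where
        i-is-b : cycle i ≡ b
        i-is-b = trans (cong (vertexAt W) i≡ℓ) (vertexAt-end W)
        j-is-a : cycle j ≡ a
        j-is-a = cong (vertexAt W)
          (trans next (trans (cong (λ k → suc k % suc (length W)) i≡ℓ) (n%n≡0 (suc (length W)))))

  every-edge-is-bridge : ∀ {p u} → Edge p u → ¬ Star (EdgeOtherThan p u) p u
  every-edge-is-bridge pu w with loopErase w
  ... | ε , _ = Edge-irrefl pu
  ... | (_ , other , _) ◅ ε , _ = other (refl , refl)
  ... | x ◅ y ◅ w′ , s = no-simple-cycle proj₁ x y w′ s (Edge-sym pu)

  walkWithin : ∀ {S} → ConnectedSet E S → ∀ {a b} → S a ≡ true → S b ≡ true →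
    Star (EdgeWithin S) a b
  walkWithin conn sa sb = fromPath (conn _ _ sa sb)
    where
    fromPath : ∀ {S a b} → PathIn E S a b → Star (EdgeWithin S) a b
    fromPath (here _) = ε
    fromPath (step sa e (here sb)) = (e , sa , sb) ◅ ε
    fromPath (step sa e p@(step sb _ _)) = (e , sa , sb) ◅ fromPath p

  pathWithin : ∀ {S a b} → S a ≡ true → Star (EdgeWithin S) a b → PathIn E S a b
  pathWithin sa ε = here sa
  pathWithin _ ((e , sa , sb) ◅ w) = step sa e (pathWithin sb w)

  within⇒avoiding : ∀ {S c} → S c ≡ false → EdgeWithin S ⇒ EdgeAvoiding c
  within⇒avoiding sc (e , sx , sy) = e , (λ { refl → not-¬ sx sc }) , (λ { refl → not-¬ sy sc })

  walkAvoiding : ∀ {S c} → ConnectedSet E S → S c ≡ false → ∀ {a b} → S a ≡ true → S b ≡ true →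
    Star (EdgeAvoiding c) a b
  walkAvoiding conn sc sa sb = map (within⇒avoiding sc) (walkWithin conn sa sb)

  avoiding⇒otherThanˡ : ∀ {p u} → EdgeAvoiding p ⇒ EdgeOtherThan p u
  avoiding⇒otherThanˡ (e , x≢p , y≢p) = e , (λ { (refl , _) → x≢p refl }) , (λ { (_ , refl) → y≢p refl })

  avoiding⇒otherThanʳ : ∀ {p u} → EdgeAvoiding u ⇒ EdgeOtherThan p u
  avoiding⇒otherThanʳ (e , x≢u , y≢u) = e , (λ { (_ , refl) → y≢u refl }) , (λ { (refl , _) → x≢u refl })

  avoiding-sym : ∀ {c} → Symmetric (EdgeAvoiding c)
  avoiding-sym (e , x≢c , y≢c) = Edge-sym e , y≢c , x≢c

  avoiding-∉ : ∀ {R} → R ⇒ Edge → ∀ {c x y} (w : Star R x y) → c ∉ vertices w →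
    Star (EdgeAvoiding c) x y
  avoiding-∉ R⊆E ε _ = ε
  avoiding-∉ R⊆E (r ◅ w) c∉ =
    (R⊆E r , (λ { refl → c∉ (here refl) }) , (λ { refl → c∉ (there (start∈vertices w)) }))
      ◅ avoiding-∉ R⊆E w (λ c∈ → c∉ (there c∈))

  -- Uniqueness of paths in a tree.
  simple-walk-unavoidable : ∀ {R} → R ⇒ Edge → ∀ {a b c} (w : Star R a b) → Simple w →
    c ∈ vertices w → Star (EdgeAvoiding c) a b → a ≢ c → b ≢ c → ⊥
  simple-walk-unavoidable R⊆E ε _ (here refl) _ a≢c _ = a≢c refl
  simple-walk-unavoidable R⊆E (_ ◅ _) _ (here refl) _ a≢c _ = a≢c refl
  simple-walk-unavoidable R⊆E {c = c} (_◅_ {j = w} r rest) (_ , s) (there c∈) bypass a≢c b≢c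
    with w ≟ c
  ... | no w≢c =
    simple-walk-unavoidable R⊆E rest s c∈ ((Edge-sym (R⊆E r) , w≢c , a≢c) ◅ bypass) w≢c b≢c
  simple-walk-unavoidable R⊆E (r ◅ ε) _ _ _ _ b≢c | yes refl = b≢c refl
  simple-walk-unavoidable R⊆E {a} {c = c} (r ◅ _◅_ {j = q} r′ rest) (a∉ , c∉ , _) _ bypass _ _
    | yes refl =
    every-edge-is-bridge (R⊆E r)
      (map avoiding⇒otherThanʳ (bypass ◅◅ reverse avoiding-sym (avoiding-∉ R⊆E rest c∉)) ◅◅ last ◅ ε)
    where
    last : EdgeOtherThan a c q c
    last = Edge-sym (R⊆E r′) , (λ { (refl , _) → a∉ (there (start∈vertices rest)) })
                             , (λ { (refl , _) → c∉ (start∈vertices rest) })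

  ∩-connected : ∀ {A B} → ConnectedSet E A → ConnectedSet E B →
    ConnectedSet E (λ v → A v ∧ B v)
  ∩-connected {A} {B} connA connB a b ab ab′ with ∧≡true⇒ {A a} ab | ∧≡true⇒ {A b} ab′
  ... | a∈A , a∈B | b∈A , b∈B with loopErase (walkWithin connA a∈A b∈A)
  ... | w , simple = inside w all-in-B a∈A
    where
    all-in-B : ∀ c → c ∈ vertices w → B c ≡ true
    all-in-B c c∈w with B c in c∈B?
    ... | true = refl
    ... | false = ⊥-elim (simple-walk-unavoidable proj₁ w simple c∈w (walkAvoiding connB c∈B? a∈B b∈B)
                    (λ { refl → not-¬ a∈B c∈B? }) (λ { refl → not-¬ b∈B c∈B? }))
    inside : ∀ {x y} (w : Star (EdgeWithin A) x y) → (∀ c → c ∈ vertices w → B c ≡ true) →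
      A x ≡ true → PathIn E (λ v → A v ∧ B v) x y
    inside ε in-B ax = here (cong₂ _∧_ ax (in-B _ (here refl)))
    inside ((e , ax , ay) ◅ w) in-B _ =
      step (cong₂ _∧_ ax (in-B _ (here refl))) e (inside w (λ c c∈ → in-B c (there c∈)) ay)

  ⁅_⁆ : Fin t → Fin t → Bool
  ⁅ v ⁆ w = isYes (w ≟ v)

  ⁅⁆-self : ∀ v → ⁅ v ⁆ v ≡ true
  ⁅⁆-self v with v ≟ v
  ... | yes _ = refl
  ... | no v≢v = ⊥-elim (v≢v refl)

  ⁅⁆-elim : ∀ {v w} → ⁅ v ⁆ w ≡ true → w ≡ v
  ⁅⁆-elim {v} {w} _ with w ≟ v
  ... | yes w≡v = w≡v

  ⁅⁆-connected : ∀ v → ConnectedSet E ⁅ v ⁆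
  ⁅⁆-connected v a b a∈ b∈ with ⁅⁆-elim a∈ | ⁅⁆-elim b∈
  ... | refl | refl = here a∈

  EdgeOutside : (Fin t → Bool) → Rel (Fin t) 0ℓ
  EdgeOutside U x y = Edge x y × U x ≡ false × U y ≡ false

  outside⇒avoiding : ∀ {U u} → U u ≡ true → EdgeOutside U ⇒ EdgeAvoiding u
  outside⇒avoiding uu (e , ux , uy) = e , (λ { refl → not-¬ uu ux }) , (λ { refl → not-¬ uu uy })

  first-entry : ∀ U {a b} → Star Edge a b → U a ≡ false → U b ≡ true →
    ∃₂ λ p u → Star (EdgeOutside U) a p × Edge p u × U p ≡ false × U u ≡ true
  first-entry U ε ua ub = ⊥-elim (not-¬ ub ua)
  first-entry U {a} (_◅_ {j = w} e rest) ua ub with U w in uw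
  ... | true = a , w , ε , e , ua , uw
  ... | false with first-entry U rest uw ub
  ...   | p , u , outside , pu , up , uu = p , u , (e , ua , uw) ◅ outside , pu , up , uu

  -- The gate u is where the tree path from W to U first enters U.
  gate : ∀ {U W} → ConnectedSet E U → ConnectedSet E W → (∀ v → U v ≡ true → W v ≡ true → ⊥) →
    ∀ {w₀ u₀} → W w₀ ≡ true → U u₀ ≡ true →
    ∃ λ u → U u ≡ true × ∀ {a b} → W a ≡ true → U b ≡ true → ¬ Star (EdgeAvoiding u) a b
  gate {U} {W} connU connW disjoint {w₀} w₀∈W u₀∈U with U w₀ in w₀∈U?
  ... | true = ⊥-elim (disjoint w₀ w₀∈U? w₀∈W)
  ... | false with first-entry U (map proj₁ (walkWithin (proj₁ (proj₂ tree)) refl refl)) w₀∈U? u₀∈U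
  ...   | p , u , outside , pu , p∉U , u∈U = u , u∈U , no-bypass
    where
    no-bypass : ∀ {a b} → W a ≡ true → U b ≡ true → ¬ Star (EdgeAvoiding u) a b
    no-bypass a∈W b∈U bypass = every-edge-is-bridge pu
      (map avoiding⇒otherThanʳ
         (reverse avoiding-sym (map (outside⇒avoiding u∈U) outside)
          ◅◅ walkAvoiding connW (¬-not (disjoint u u∈U)) w₀∈W a∈W
          ◅◅ bypass)
       ◅◅ map avoiding⇒otherThanˡ (walkAvoiding connU p∉U b∈U u∈U))

  _∖_ : (Fin t → Bool) → Fin t → Fin t → Bool
  (A ∖ v) z = A z ∧ not (isYes (z ≟ v))

  ∖-intro : ∀ {A v z} → A z ≡ true → z ≢ v → (A ∖ v) z ≡ true
  ∖-intro {v = v} {z} az z≢v with z ≟ v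
  ... | yes z≡v = ⊥-elim (z≢v z≡v)
  ... | no _ = cong (_∧ true) az

  ∖-elim : ∀ {A v z} → (A ∖ v) z ≡ true → A z ≡ true × z ≢ v
  ∖-elim {A} {v} {z} a∖v with A z | z ≟ v
  ... | true | no z≢v = refl , z≢v

  remove-pendant : ∀ {A} → ConnectedSet E A → ∀ {v q} → (∀ {z} → Edge v z → A z ≡ true → z ≡ q) →
    ConnectedSet E (A ∖ v)
  remove-pendant {A} connA {v} pendant a b a∈A∖v b∈A∖v with ∖-elim {A} a∈A∖v | ∖-elim {A} b∈A∖v
  ... | a∈A , a≢v | b∈A , b≢v = pathWithin a∈A∖v (skip-v (walkWithin connA a∈A b∈A) a≢v b≢v)
    where
    skip-v : ∀ {x y} → Star (EdgeWithin A) x y → x ≢ v → y ≢ v → Star (EdgeWithin (A ∖ v)) x y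
    skip-v ε _ _ = ε
    skip-v (_◅_ {j = w} (e , ax , aw) rest) x≢v y≢v with w ≟ v
    ... | no w≢v = (e , ∖-intro {A} ax x≢v , ∖-intro {A} aw w≢v) ◅ skip-v rest w≢v y≢v
    skip-v (_ ◅ ε) _ y≢v | yes refl = ⊥-elim (y≢v refl)
    skip-v ((e , ax , _) ◅ (e′ , _ , aw′) ◅ rest) x≢v y≢v | yes refl
      with pendant (Edge-sym e) ax | pendant e′ aw′
    ... | refl | refl = skip-v rest x≢v y≢v

  chain-walk : ∀ (C : ℕ → Fin t → Bool) → (∀ j → ConnectedSet E (C j)) → ∀ {c} k →
    (∀ j → j ≤ k → C j c ≡ false) →
    (∀ j → j < k → ∃ λ w → C j w ≡ true × C (suc j) w ≡ true) →
    ∀ {a b} → C 0 a ≡ true → C k b ≡ true → Star (EdgeAvoiding c) a b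
  chain-walk C conn zero avoid _ a∈ b∈ = walkAvoiding (conn 0) (avoid 0 z≤n) a∈ b∈
  chain-walk C conn (suc k) avoid meet a∈ b∈ with meet k (n<1+n k)
  ... | w , w∈Cₖ , w∈Cₖ₊₁ =
    chain-walk C conn k (λ j j≤k → avoid j (m≤n⇒m≤1+n j≤k)) (λ j j<k → meet j (m<n⇒m<1+n j<k)) a∈ w∈Cₖ
      ◅◅ walkAvoiding (conn (suc k)) (avoid (suc k) ≤-refl) w∈Cₖ₊₁ b∈

  module IntersectionGraph {V : Set} (_≟V_ : DecidableEquality V) (S : V → Fin t → Bool)
                           (connected : ∀ x → ConnectedSet E (S x)) where

    Meet : V → V → Set
    Meet x y = x ≢ y × ∃ λ w → S x w ≡ true × S y w ≡ true

    meet? : ∀ x y → Dec (Meet x y)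
    meet? x y = ¬? (x ≟V y) ×-dec any? (λ w → (S x w ≟B true) ×-dec (S y w ≟B true))

    G : Rel₂ V
    G x y = isYes (meet? x y)

    G-intro : ∀ {x y} → Meet x y → G x y ≡ true
    G-intro {x} {y} meet with meet? x y
    ... | yes _ = refl
    ... | no ¬meet = ⊥-elim (¬meet meet)

    G-elim : ∀ {x y} → G x y ≡ true → Meet x y
    G-elim {x} {y} _ with meet? x y
    ... | yes meet = meet

    G-isGraph : IsGraph G
    G-isGraph = (λ x y → bool-ext (G-intro ∘ swap ∘ G-elim) (G-intro ∘ swap ∘ G-elim))
              , (λ x → ¬-not (λ Gxx → proj₁ (G-elim Gxx) refl))
      where
      swap : ∀ {x y} → Meet x y → Meet y x
      swap (x≢y , w , x∋w , y∋w) = x≢y ∘ sym , w , y∋w , x∋w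

    module _ (r : ℕ) (f : Fin (4 + r) → V) (f-injective : ∀ i j → f i ≡ f j → i ≡ j)
             (consecutive : ∀ i j → Next i j → G (f i) (f j) ≡ true) where

      L : ℕ
      L = 4 + r

      at : ℕ → Fin L
      at j = fromℕ< (m%n<n j L)

      toℕ-at : ∀ {j} → j < L → toℕ (at j) ≡ j
      toℕ-at {j} j<L = trans (toℕ-fromℕ< (m%n<n j L)) (m<n⇒m%n≡m j<L)

      at-L : at L ≡ at 0
      at-L = toℕ-injective (trans (toℕ-fromℕ< (m%n<n L L)) (n%n≡0 L))

      next-at : ∀ j → Next (at j) (at (suc j))
      next-at j = begin
        toℕ (at (suc j))               ≡⟨ toℕ-fromℕ< (m%n<n (suc j) L) ⟩
        (1 + j) % L                    ≡⟨ %-distribˡ-+ 1 j L ⟩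
        (1 % L + j % L) % L            ≡⟨ cong (λ k → (1 % L + k) % L) (sym (m%n%n≡m%n j L)) ⟩
        (1 % L + j % L % L) % L        ≡⟨ sym (%-distribˡ-+ 1 (j % L) L) ⟩
        suc (j % L) % L                ≡⟨ cong (λ k → suc k % L) (sym (toℕ-fromℕ< (m%n<n j L))) ⟩
        suc (toℕ (at j)) % L           ∎
        where open ≡-Reasoning

      Sₐₜ : ℕ → Fin t → Bool
      Sₐₜ j = S (f (at j))

      meet : ∀ j → ∃ λ w → Sₐₜ j w ≡ true × Sₐₜ (suc j) w ≡ true
      meet j = proj₂ (G-elim (consecutive _ _ (next-at j)))

      Chord : Set
      Chord = ∃₂ λ i j → G (f i) (f j) ≡ true × ¬ Next i j × ¬ Next j i

      chord : ∀ {i j w} → S (f i) w ≡ true → S (f j) w ≡ true → 2 + toℕ i ≤ toℕ j →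
        0 < toℕ i ⊎ 2 + toℕ j ≤ L → Chord
      chord {i} {j} {w} i∋w j∋w i+2≤j wrap =
        i , j , G-intro (f-i≢f-j , w , i∋w , j∋w) , non-consecutive i+2≤j wrap
        where
        f-i≢f-j : f i ≢ f j
        f-i≢f-j eq =
          1+n≰n (≤-trans (n≤1+n _) (subst (λ k → 2 + toℕ k ≤ toℕ j) (f-injective i j eq) i+2≤j))

      -- If S₀ and S₂ are disjoint, let u be the gate of S₀ towards S₂. Both S₁ and the chain
      -- S₂ S₃ … Sₗ₋₁ S₀ connect S₂ to S₀, so u lies in S₁ and in some Sⱼ with j ≥ 3: a chord 1–j.
      cycle-has-chord : Chord
      cycle-has-chord with meet 0 | meet 1
      ... | z₀₁ , z₀₁∈S₀ , z₀₁∈S₁ | z₁₂ , z₁₂∈S₁ , z₁₂∈S₂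
        with any? (λ w → (Sₐₜ 0 w ≟B true) ×-dec (Sₐₜ 2 w ≟B true))
      ... | yes (w , w∈S₀ , w∈S₂) = chord w∈S₀ w∈S₂ ≤-refl (inj₂ (s≤s (s≤s (s≤s (s≤s z≤n)))))
      ... | no S₀∩S₂=∅
        with gate (connected _) (connected _) (λ v v∈S₀ v∈S₂ → S₀∩S₂=∅ (v , v∈S₀ , v∈S₂)) z₁₂∈S₂ z₀₁∈S₀
      ... | u , u∈S₀ , separates with Sₐₜ 1 u in u∈S₁?
      ...   | false = ⊥-elim (separates z₁₂∈S₂ z₀₁∈S₀ (walkAvoiding (connected _) u∈S₁? z₁₂∈S₁ z₀₁∈S₁))
      ...   | true with any? (λ j → (3 ≤? toℕ j) ×-dec (S (f j) u ≟B true))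
      ...     | yes (j , 3≤j , u∈Sⱼ) = chord u∈S₁? u∈Sⱼ 3≤j (inj₁ (s≤s z≤n))
      ...     | no u∉S₃…Sₗ₋₁ with meet (3 + r)
      ...       | z , z∈Sₗ₋₁ , z∈Sₗ =
        ⊥-elim (separates z₁₂∈S₂ (subst (λ k → S (f k) z ≡ true) at-L z∈Sₗ)
          (chain-walk (λ j → Sₐₜ (2 + j)) (λ _ → connected _) (suc r) avoids (λ j _ → meet (2 + j))
            z₁₂∈S₂ z∈Sₗ₋₁))
        where
        avoids : ∀ j → j ≤ suc r → Sₐₜ (2 + j) u ≡ false
        avoids zero _ = ¬-not (λ u∈S₂ → S₀∩S₂=∅ (u , u∈S₀ , u∈S₂))
        avoids (suc j) j≤r = ¬-not (λ u∈S → u∉S₃…Sₗ₋₁ (at (3 + j) , 3≤at , u∈S))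
          where
          3≤at : 3 ≤ toℕ (at (3 + j))
          3≤at = subst (3 ≤_) (sym (toℕ-at (s≤s (s≤s (s≤s j≤r))))) (s≤s (s≤s (s≤s z≤n)))

    G-chordal : Chordal G
    G-chordal r f (f-injective , consecutive) = cycle-has-chord r f f-injective consecutive

∣p∣≡0⇒∉ : ∀ {n} (p : Subset n) → ∣ p ∣ ≡ 0 → ∀ z → z ∉ₛ p
∣p∣≡0⇒∉ (false ∷ p) empty (suc z) (there z∈p) = ∣p∣≡0⇒∉ p empty z z∈p

∣p∣≡1⇒singleton : ∀ {n} (p : Subset n) → ∣ p ∣ ≡ 1 → ∃ λ i → i ∈ₛ p × ∀ z → z ∈ₛ p → z ≡ i
∣p∣≡1⇒singleton (true ∷ p) one = zero , here , λ
  { zero _ → refl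
  ; (suc z) (there z∈p) → ⊥-elim (∣p∣≡0⇒∉ p (suc-injective one) z z∈p) }
∣p∣≡1⇒singleton (false ∷ p) one with ∣p∣≡1⇒singleton p one
... | i , i∈p , only-i = suc i , there i∈p , λ { (suc z) (there z∈p) → cong suc (only-i z z∈p) }

∣p∣≡2⇒⊆pair : ∀ {n} (p : Subset n) → ∣ p ∣ ≡ 2 →
  ∃₂ λ i j → i ∈ₛ p × ∀ z → z ∈ₛ p → z ≡ i ⊎ z ≡ j
∣p∣≡2⇒⊆pair (true ∷ p) two with ∣p∣≡1⇒singleton p (suc-injective two)
... | j , _ , only-j = zero , suc j , here , λ
  { zero _ → inj₁ refl
  ; (suc z) (there z∈p) → inj₂ (cong suc (only-j z z∈p)) }
∣p∣≡2⇒⊆pair (false ∷ p) two with ∣p∣≡2⇒⊆pair p two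
... | i , j , i∈p , i-or-j = suc i , suc j , there i∈p ,
  λ { (suc z) (there z∈p) → Sum.map (cong suc) (cong suc) (i-or-j z z∈p) }

∈ₛ-tabulate⁻ : ∀ {n} (f : Fin n → Bool) {z} → z ∈ₛ tabulate f → f z ≡ true
∈ₛ-tabulate⁻ f {z} z∈ = trans (sym (lookup∘tabulate f z)) ([]=⇒lookup z∈)

∈ₛ-tabulate⁺ : ∀ {n} (f : Fin n → Bool) {z} → f z ≡ true → z ∈ₛ tabulate f
∈ₛ-tabulate⁺ f {z} fz = lookup⇒[]= z (tabulate f) (trans (lookup∘tabulate f z) fz)

degree≡2⇒neighbours : ∀ {t} (E : Rel₂ (Fin t)) {v} → degree E v ≡ 2 →
  ∃₂ λ w₁ w₂ → E v w₁ ≡ true × ∀ z → E v z ≡ true → z ≡ w₁ ⊎ z ≡ w₂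
degree≡2⇒neighbours E {v} deg with ∣p∣≡2⇒⊆pair (tabulate (E v)) deg
... | w₁ , w₂ , w₁∈ , w₁-or-w₂ =
  w₁ , w₂ , ∈ₛ-tabulate⁻ (E v) w₁∈ , λ z vz → w₁-or-w₂ z (∈ₛ-tabulate⁺ (E v) vz)

module CliqueTreeOfMinimalTriangulation
  {n m} {k : Fin m → ℕ} (cell : Cells n k) (nonempty : ∀ i j → Nonempty (cell i j))
  (H : Rel₂ (Vtx k)) (minimal : IsMinimalTriangulation (IntC cell) H)
  {t} (ET : Rel₂ (Fin t)) (K : Fin t → Vtx k → Bool) (cliqueTree : IsCliqueTree H ET K)
  (φ : Fin n → Fin t) (candidate : ∀ a → IsCandidate cell K a (φ a)) where

  open Tree ET (proj₁ cliqueTree)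

  private
    maximal : ∀ v → IsMaximalClique H (K v)
    maximal = proj₁ (proj₂ cliqueTree)
    K-injective : ∀ v w → (∀ x → K v x ≡ K w x) → v ≡ w
    K-injective = proj₁ (proj₂ (proj₂ cliqueTree))
    H⇔together : ∀ x y → x ≢ y → (H x y ≡ true ⇔ ∃ λ v → K v x ≡ true × K v y ≡ true)
    H⇔together = proj₁ (proj₂ (proj₂ (proj₂ (proj₂ cliqueTree))))
    K-connected : ∀ x → ConnectedSet ET (λ v → K v x)
    K-connected = proj₂ (proj₂ (proj₂ (proj₂ (proj₂ cliqueTree))))

  _≟V_ : DecidableEquality (Vtx k)
  _≟V_ = ≡-dec _≟_ _≟_

  H⇒≢ : ∀ {x y} → H x y ≡ true → x ≢ y
  H⇒≢ {x} Hxy refl = not-¬ Hxy (proj₂ (proj₁ (proj₁ minimal)) x)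

  K-⊆⇒≡ : ∀ {v u} → (∀ x → K v x ≡ true → K u x ≡ true) → v ≡ u
  K-⊆⇒≡ {v} {u} Kv⊆Ku =
    K-injective v u (λ x → bool-ext (Kv⊆Ku x) (proj₂ (maximal v) (K u) (proj₁ (maximal u)) Kv⊆Ku x))

  -- The intersection graph G of S is chordal and lies between int(C) and H, so minimality gives H ⊆ G.
  H⊆intersections : (S : Vtx k → Fin t → Bool) → (∀ x → ConnectedSet ET (S x)) →
    (∀ x w → S x w ≡ true → K w x ≡ true) → (∀ x a → a ∈ₛ cellOf cell x → S x (φ a) ≡ true) →
    ∀ x y → H x y ≡ true → ∃ λ w → S x w ≡ true × S y w ≡ true
  H⊆intersections S S-connected S⊆K φ∈S x y Hxy =
    proj₂ (G-elim (proj₂ minimal G G-triangulation G⊆H x y Hxy))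
    where
    open IntersectionGraph _≟V_ S S-connected
    G-triangulation : IsTriangulation (IntC cell) G
    G-triangulation = G-isGraph , int⊆G , G-chordal
      where
      int⊆G : ∀ x y → IntC cell x y → G x y ≡ true
      int⊆G x y (x≢y , a , a∈x∩y) = G-intro (x≢y , φ a , φ∈S x a (x∈p∩q⁻ _ _ a∈x∩y .proj₁)
                                                       , φ∈S y a (x∈p∩q⁻ _ _ a∈x∩y .proj₂))
    G⊆H : ∀ x y → G x y ≡ true → H x y ≡ true
    G⊆H x y Gxy with G-elim Gxy
    ... | x≢y , w , x∋w , y∋w = Equivalence.from (H⇔together x y x≢y) (w , S⊆K x w x∋w , S⊆K y w y∋w)

  span⇒clique : ∀ x v → InSpan ET φ (cellOf cell x) v → K v x ≡ true
  span⇒clique x v v∈span = v∈span (λ w → K w x) (K-connected x) (λ a a∈x → candidate a x a∈x)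

  module Restriction (x : Vtx k) (S : Fin t → Bool) (S-connected : ConnectedSet ET S)
                     (φA⊆S : ∀ a → a ∈ₛ cellOf cell x → S (φ a) ≡ true) where

    R : Vtx k → Fin t → Bool
    R y = if isYes (y ≟V x) then S else λ _ → true

    S′ : Vtx k → Fin t → Bool
    S′ y w = K w y ∧ R y w

    S′⊆K : ∀ y w → S′ y w ≡ true → K w y ≡ true
    S′⊆K y w = ∧-conicalˡ (K w y) (R y w)

    S′-connected : ∀ y → ConnectedSet ET (S′ y)
    S′-connected y = ∩-connected (K-connected y) R-connected
      where
      R-connected : ConnectedSet ET (R y)
      R-connected with y ≟V x
      ... | yes _ = S-connected
      ... | no _ = proj₁ (proj₂ (proj₁ cliqueTree))

    φ∈S′ : ∀ y a → a ∈ₛ cellOf cell y → S′ y (φ a) ≡ true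
    φ∈S′ y a a∈y = cong₂ _∧_ (candidate a y a∈y) φ∈R
      where
      φ∈R : R y (φ a) ≡ true
      φ∈R with y ≟V x
      ... | yes refl = φA⊆S a a∈y
      ... | no _ = refl

    S′x⊆S : ∀ {w} → S′ x w ≡ true → S w ≡ true
    S′x⊆S {w} w∈S′x = ∧-conicalʳ (K w x) (S w) (subst (λ P → K w x ∧ P w ≡ true) R-self w∈S′x)
      where
      R-self : R x ≡ S
      R-self = cong (λ d → if isYes d then S else λ _ → true) (≡-≟-identity _≟V_ {x} refl)

    -- Each y in v's clique is H-adjacent to x, so S′ y meets S′ x; the path in T_K(y) from v to
    -- that meeting point must pass through the separating node u.
    separator-clique-⊇ : ∀ {v u} → K v x ≡ true → S′ x u ≡ true →
      (∀ {b} → S′ x b ≡ true → ¬ Star (EdgeAvoiding u) v b) →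
      ∀ y → K v y ≡ true → K u y ≡ true
    separator-clique-⊇ {v} {u} Kvx u∈S′x separates y Kvy with y ≟V x
    ... | yes refl = S′⊆K x u u∈S′x
    ... | no y≢x with H⊆intersections S′ S′-connected S′⊆K φ∈S′ x y
                        (Equivalence.from (H⇔together x y (y≢x ∘ sym)) (v , Kvx , Kvy))
    ...   | w , w∈S′x , w∈S′y with K u y in u∈Ty?
    ...     | true = refl
    ...     | false = ⊥-elim (separates w∈S′x
                (walkAvoiding (K-connected y) u∈Ty? Kvy (S′⊆K y w w∈S′y)))

    -- If v ∉ S, the gate u of S′ x towards v has v's clique inside its own, so v = u ∈ S.
    K⊆S : ∀ {v} → K v x ≡ true → S v ≡ true
    K⊆S {v} Kvx with S v in v∈S?
    ... | true = refl
    ... | false with nonempty (proj₁ x) (proj₂ x)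
    ...   | a₀ , a₀∈x with gate (S′-connected x) (⁅⁆-connected v) v∉S′x (⁅⁆-self v) (φ∈S′ x a₀ a₀∈x)
      where
      v∉S′x : ∀ w → S′ x w ≡ true → ⁅ v ⁆ w ≡ true → ⊥
      v∉S′x w w∈S′x w∈⁅v⁆ with ⁅⁆-elim w∈⁅v⁆
      ... | refl = not-¬ (S′x⊆S w∈S′x) v∈S?
    ...     | u , u∈S′x , separates = ⊥-elim (not-¬ (S′x⊆S u∈S′x) (subst (λ w → S w ≡ false) v≡u v∈S?))
      where
      v≡u : v ≡ u
      v≡u = K-⊆⇒≡ (separator-clique-⊇ Kvx u∈S′x (separates (⁅⁆-self v)))

  clique⇒span : ∀ x v → K v x ≡ true → InSpan ET φ (cellOf cell x) v
  clique⇒span x v Kvx S S-connected φA⊆S = K⊆S Kvx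
    where open Restriction x S S-connected φA⊆S

  span⇔clique : ∀ x v → InSpan ET φ (cellOf cell x) v ⇔ K v x ≡ true
  span⇔clique x v = mk⇔ (span⇒clique x v) (clique⇒span x v)

  H⇔intCT : ∀ x y → H x y ≡ true ⇔ IntCT cell ET φ x y
  H⇔intCT x y = mk⇔ to from
    where
    to : H x y ≡ true → IntCT cell ET φ x y
    to Hxy with Equivalence.to (H⇔together x y (H⇒≢ Hxy)) Hxy
    ... | v , Kvx , Kvy = H⇒≢ Hxy , v , clique⇒span x v Kvx , clique⇒span y v Kvy
    from : IntCT cell ET φ x y → H x y ≡ true
    from (x≢y , v , v∈x , v∈y) =
      Equivalence.from (H⇔together x y x≢y) (v , span⇒clique x v v∈x , span⇒clique y v v∈y)

  -- Let w₁, w₂ be the neighbours of a degree-two node v outside φ(X). If K v ⊈ K w₁, some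
  -- T_K(x) ∋ v avoids w₁; removing v leaves a subtree containing φ(A), contradicting clique⇒span.
  no-suppression : NoSuppression ET φ
  no-suppression v deg with any? (λ a → φ a ≟ v)
  ... | yes v∈image = v∈image
  ... | no v∉image with degree≡2⇒neighbours ET deg
  ...   | w₁ , w₂ , v-w₁ , w₁-or-w₂ = ⊥-elim (Edge-irrefl (subst (Edge v) (sym (K-⊆⇒≡ Kv⊆Kw₁)) v-w₁))
    where
    Kv⊆Kw₁ : ∀ x → K v x ≡ true → K w₁ x ≡ true
    Kv⊆Kw₁ x Kvx with K w₁ x in Kw₁x
    ... | true = refl
    ... | false = ⊥-elim (proj₂ (∖-elim {Tx} v∈Tx∖v) refl)
      where
      Tx : Fin t → Bool
      Tx w = K w x
      only-w₂ : ∀ {z} → Edge v z → K z x ≡ true → z ≡ w₂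
      only-w₂ v-z Kzx with w₁-or-w₂ _ v-z
      ... | inj₁ refl = ⊥-elim (not-¬ Kzx Kw₁x)
      ... | inj₂ z≡w₂ = z≡w₂
      v∈Tx∖v : (Tx ∖ v) v ≡ true
      v∈Tx∖v = clique⇒span x v Kvx (Tx ∖ v) (remove-pendant (K-connected x) only-w₂)
        (λ a a∈x → ∖-intro {Tx} (candidate a x a∈x) (λ φa≡v → v∉image (a , φa≡v)))

theorem10 : ∀ {n m : ℕ} {k : Fin m → ℕ} (cell : Cells n k) → IsCharacterSet cell →
    (H : Rel₂ (Vtx k)) → IsMinimalTriangulation (IntC cell) H →
    ∀ {t : ℕ} (ET : Rel₂ (Fin t)) (K : Fin t → Vtx k → Bool) → IsCliqueTree H ET K →
    (φ : Fin n → Fin t) → (∀ a → IsCandidate cell K a (φ a)) →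
    NoSuppression ET φ ×
    (∀ x v → (InSpan ET φ (cellOf cell x) v ⇔ K v x ≡ true)) ×
    (∀ x y → (H x y ≡ true ⇔ IntCT cell ET φ x y))
theorem10 cell (nonempty , _) H minimal ET K cliqueTree φ candidate =
  no-suppression , span⇔clique , H⇔intCT
  where open CliqueTreeOfMinimalTriangulation cell nonempty H minimal ET K cliqueTree φ candidate
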